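{- For every $n\ge0$, \[ \sum_{\pi\in\mathrm{Sch}_n}\mathrm{wt}(\pi)=(a+1)_n, \] where $(y)_n=y(y+1)\cdots(y+n-1)$.
   Context: Let $a$ be an indeterminate (or complex number). A Schröder path (in this paper's sense) is a lattice path never going below the $x$-axis with steps up $U=(1,1)$, horizontal $H=(1,0)$ and vertical down $V=(0,-1)$; $\mathrm{Sch}_n$ is the set of such paths from $(0,0)$ to $(n,0)$. The weight $\mathrm{wt}(\pi)$ is the product of step weights with respect to $b_k=a-k$, $a_k=k$: up steps have weight $1$, a horizontal step starting at height $k$ has weight $a-k$, and a vertical down step starting at height $k$ has weight $k$. -}

module Defs where

open import Level using (Level)
open import Data.Nat using (ℕ; zero; suc; _≡ᵇ_) renaming (_*_ to _*ℕ_)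
open import Data.Bool using (Bool; true; false; _∧_)
open import Data.List using (List; []; _∷_; map; concatMap; filterᵇ; upTo; foldr)
open import Algebra.Bundles using (CommutativeRing)

-- Steps of a Schröder path: U = (1,1), H = (1,0), V = (0,-1).
data Step : Set where
  U H V : Step

wordsOf : ℕ → List (List Step)
wordsOf zero = [] ∷ []
wordsOf (suc k) = concatMap (λ w → (U ∷ w) ∷ (H ∷ w) ∷ (V ∷ w) ∷ []) (wordsOf k)

validFrom : ℕ → ℕ → List Step → Bool
validFrom h x [] = (h ≡ᵇ 0) ∧ (x ≡ᵇ 0)
validFrom h zero (U ∷ w) = false
validFrom h (suc x) (U ∷ w) = validFrom (suc h) x w
validFrom h zero (H ∷ w) = false
validFrom h (suc x) (H ∷ w) = validFrom h x w
validFrom zero x (V ∷ w) = false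
validFrom (suc h) x (V ∷ w) = validFrom h x w

-- Any such path has n horizontal-advancing steps (U or H) and as many V as U,
-- hence length ≤ 2n; we enumerate all words of length 0..2n and filter.
Sch : ℕ → List (List Step)
Sch n = filterᵇ (validFrom 0 n) (concatMap wordsOf (upTo (suc (2 *ℕ n))))

module _ {c ℓ : Level} (R : CommutativeRing c ℓ) where
  open CommutativeRing R using (Carrier; _+_; _*_; _-_; 0#; 1#)

  ι : ℕ → Carrier
  ι zero = 0#
  ι (suc k) = 1# + ι k

  wtFrom : Carrier → ℕ → List Step → Carrier
  wtFrom a h [] = 1#
  wtFrom a h (U ∷ w) = 1# * wtFrom a (suc h) w
  wtFrom a h (H ∷ w) = (a - ι h) * wtFrom a h w
  wtFrom a zero (V ∷ w) = ι zero * wtFrom a zero w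
  wtFrom a (suc h) (V ∷ w) = ι (suc h) * wtFrom a h w

  wt : Carrier → List Step → Carrier
  wt a = wtFrom a 0

  sumR : List Carrier → Carrier
  sumR = foldr _+_ 0#

  prodR : List Carrier → Carrier
  prodR = foldr _*_ 1#

  rising : Carrier → ℕ → Carrier
  rising y n = prodR (map (λ i → y + ι i) (upTo n))

-- Let S h x be the total weight of the paths that start at height h and must
-- advance x units before ending on the axis (so Sch n is the case h = 0, x = n).
-- Splitting off the first step gives S 0 0 = 1 and
--   S h x = S (h+1) (x-1) + (a - h) S h (x-1) + h S (h-1) x,
-- omitting terms with a negative index. The closed form (x+1)_h (a+1)_x obeys the
-- same recurrence, which after cancelling common factors is the identity
--   y (y + k) + (a - k) y + k (a + y) = (y + k) (a + y)   (y = x, k = h).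
-- Since Sch enumerates words by length, S is approximated by sums over words of
-- length at most N; these agree with the closed form once N ≥ h + 2x, a bound on
-- the length of such paths, so induction on N with measure h + 2x concludes.
module Submission where

open import Defs
open import Data.Nat using (ℕ)
open import Data.List using (map)
open import Algebra.Bundles using (CommutativeRing)

open import Algebra.Bundles using (Monoid)
open import Data.Bool using (Bool; true; false; if_then_else_)
open import Data.List using (List; []; _∷_; _++_; foldr; concatMap; filterᵇ; upTo)
open import Data.List.Properties using (upTo-∷ʳ; map-upTo; map-applyUpTo)
open import Data.Nat using (zero; suc; _<_; _≤_; s≤s⁻¹) renaming (_+_ to _+ℕ_; _*_ to _*ℕ_)
open import Data.Nat.Properties using (≤-refl; ≤-reflexive; ≤-trans; <-trans; n<1+n)
open import Data.Nat.Tactic.RingSolver using (solve-∀)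
open import Function using (_∘_)
open import Relation.Binary.PropositionalEquality as ≡ using (_≡_)
import Algebra.Properties.AbelianGroup as AbelianGroupProperties
import Algebra.Solver.Ring.NaturalCoefficients.Default as NatCoeffSolver

module MonoidFold {c ℓ} (M : Monoid c ℓ) where
  open Monoid M

  foldMap : ∀ {a} {A : Set a} → (A → Carrier) → List A → Carrier
  foldMap f xs = foldr _∙_ ε (map f xs)

  foldMap-++ : ∀ {a} {A : Set a} (f : A → Carrier) xs ys →
               foldMap f (xs ++ ys) ≈ foldMap f xs ∙ foldMap f ys
  foldMap-++ f []       ys = sym (identityˡ _)
  foldMap-++ f (x ∷ xs) ys = trans (∙-congˡ (foldMap-++ f xs ys)) (sym (assoc _ _ _))

  foldMap-concatMap : ∀ {a b} {A : Set a} {B : Set b} (f : B → Carrier) (g : A → List B) xs →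
                      foldMap f (concatMap g xs) ≈ foldMap (foldMap f ∘ g) xs
  foldMap-concatMap f g []       = refl
  foldMap-concatMap f g (x ∷ xs) =
    trans (foldMap-++ f (g x) (concatMap g xs)) (∙-congˡ (foldMap-concatMap f g xs))

  foldMap-upTo-suc : ∀ {f : ℕ → Carrier} n → foldMap f (upTo (suc n)) ≡ f 0 ∙ foldMap (f ∘ suc) (upTo n)
  foldMap-upTo-suc {f} n =
    ≡.cong (λ xs → f 0 ∙ foldr _∙_ ε xs) (≡.trans (map-applyUpTo suc f n) (≡.sym (map-upTo (f ∘ suc) n)))

  foldMap-cong : ∀ {a} {A : Set a} {f g : A → Carrier} → (∀ x → f x ≈ g x) → ∀ xs →
                 foldMap f xs ≈ foldMap g xs
  foldMap-cong f≈g []       = refl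
  foldMap-cong f≈g (x ∷ xs) = ∙-cong (f≈g x) (foldMap-cong f≈g xs)

-- The clauses of validFrom match on the horizontal budget before a V step.
validFrom-V : ∀ h x w → validFrom (suc h) x (V ∷ w) ≡ validFrom h x w
validFrom-V h zero    w = ≡.refl
validFrom-V h (suc x) w = ≡.refl

rank : ℕ → ℕ → ℕ
rank h x = h +ℕ 2 *ℕ x

rank-sucʳ : ∀ h x → h +ℕ 2 *ℕ suc x ≡ 2 +ℕ (h +ℕ 2 *ℕ x)
rank-sucʳ = solve-∀

rank-V : ∀ h x → rank h x < rank (suc h) x
rank-V h x = n<1+n (rank h x)

rank-U : ∀ h x → rank (suc h) x < rank h (suc x)
rank-U h x = ≤-reflexive (≡.sym (rank-sucʳ h x))

rank-H : ∀ h x → rank h x < rank h (suc x)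
rank-H h x = <-trans (rank-V h x) (rank-U h x)

module _ {c ℓ} (R : CommutativeRing c ℓ) where
  open CommutativeRing R hiding (zero)
  open import Relation.Binary.Reasoning.Setoid setoid
  -- In this solver con 1 means 1# + 0#, so 1# is passed in as a variable o
  -- wherever it occurs; none of those identities needs 1# * z ≈ z.
  open NatCoeffSolver commutativeSemiring using (solve; _:=_; _:+_; _:*_; con)
  open AbelianGroupProperties +-abelianGroup using (//-rightDividesˡ; ε⁻¹≈ε)
  open MonoidFold +-monoid using ()
    renaming (foldMap to ∑; foldMap-concatMap to ∑-concatMap; foldMap-upTo-suc to ∑-upTo-suc; foldMap-cong to ∑-cong)
  open MonoidFold *-monoid using ()
    renaming (foldMap to ∏; foldMap-++ to ∏-++; foldMap-upTo-suc to ∏-upTo-suc; foldMap-cong to ∏-cong)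

  ∑-+ : ∀ {a} {A : Set a} (f g : A → Carrier) xs → ∑ (λ x → f x + g x) xs ≈ ∑ f xs + ∑ g xs
  ∑-+ f g []       = sym (+-identityˡ 0#)
  ∑-+ f g (x ∷ xs) = trans (+-congˡ (∑-+ f g xs))
    (solve 4 (λ u v U V → (u :+ v) :+ (U :+ V) := (u :+ U) :+ (v :+ V)) refl (f x) (g x) _ _)

  ∑-*ˡ : ∀ {a} {A : Set a} k (f : A → Carrier) xs → ∑ (λ x → k * f x) xs ≈ k * ∑ f xs
  ∑-*ˡ k f []       = sym (zeroʳ k)
  ∑-*ˡ k f (x ∷ xs) = trans (+-congˡ (∑-*ˡ k f xs)) (sym (distribˡ k _ _))

  ∑-zero : ∀ {a} {A : Set a} (xs : List A) → ∑ (λ _ → 0#) xs ≈ 0#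
  ∑-zero []       = refl
  ∑-zero (x ∷ xs) = trans (+-identityˡ _) (∑-zero xs)

  ∑-filterᵇ : ∀ {a} {A : Set a} (p : A → Bool) (f : A → Carrier) xs →
              ∑ f (filterᵇ p xs) ≈ ∑ (λ x → if p x then f x else 0#) xs
  ∑-filterᵇ p f []       = refl
  ∑-filterᵇ p f (x ∷ xs) with p x
  ... | true  = +-congˡ (∑-filterᵇ p f xs)
  ... | false = trans (∑-filterᵇ p f xs) (sym (+-identityˡ _))

  rising-sucʳ : ∀ y n → rising R y (suc n) ≈ rising R y n * (y + ι R n)
  rising-sucʳ y n = begin
    ∏ f (upTo (suc n))        ≡⟨ ≡.cong (∏ f) (upTo-∷ʳ n) ⟨
    ∏ f (upTo n ++ n ∷ [])    ≈⟨ ∏-++ f (upTo n) (n ∷ []) ⟩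
    ∏ f (upTo n) * (f n * 1#) ≈⟨ *-congˡ (*-identityʳ (f n)) ⟩
    ∏ f (upTo n) * f n        ∎
    where f = λ i → y + ι R i

  rising-sucˡ : ∀ y n → rising R y (suc n) ≈ y * rising R (1# + y) n
  rising-sucˡ y n = begin
    rising R y (suc n)                            ≡⟨ ∏-upTo-suc n ⟩
    (y + 0#) * ∏ (λ i → y + ι R (suc i)) (upTo n) ≈⟨ *-cong (+-identityʳ y) (∏-cong shift (upTo n)) ⟩
    y * rising R (1# + y) n                       ∎
    where
    shift : ∀ i → y + (1# + ι R i) ≈ (1# + y) + ι R i
    shift i = solve 3 (λ y o i → y :+ (o :+ i) := (o :+ y) :+ i) refl y 1# (ι R i)

  rising-one : ∀ y → rising R y 1 ≈ y
  rising-one y = trans (*-identityʳ _) (+-identityʳ y)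

  sumWords : ℕ → (List Step → Carrier) → Carrier
  sumWords N f = ∑ f (concatMap wordsOf (upTo (suc N)))

  ∑-wordsOf-suc : ∀ (f : List Step → Carrier) L →
                  ∑ f (wordsOf (suc L)) ≈ ∑ (λ w → f (U ∷ w) + (f (H ∷ w) + f (V ∷ w))) (wordsOf L)
  ∑-wordsOf-suc f L = trans (∑-concatMap f _ (wordsOf L))
    (∑-cong (λ w → +-congˡ (+-congˡ (+-identityʳ (f (V ∷ w))))) (wordsOf L))

  sumWords-suc : ∀ N f → sumWords (suc N) f ≈ f [] + sumWords N (λ w → f (U ∷ w) + (f (H ∷ w) + f (V ∷ w)))
  sumWords-suc N f = begin
    sumWords (suc N) f                                   ≈⟨ ∑-concatMap f wordsOf (upTo (suc (suc N))) ⟩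
    ∑ (∑ f ∘ wordsOf) (upTo (suc (suc N)))               ≡⟨ ∑-upTo-suc (suc N) ⟩
    (f [] + 0#) + ∑ (∑ f ∘ wordsOf ∘ suc) (upTo (suc N)) ≈⟨ +-cong (+-identityʳ (f [])) (∑-cong (∑-wordsOf-suc f) (upTo (suc N))) ⟩
    f [] + ∑ (∑ g ∘ wordsOf) (upTo (suc N))              ≈⟨ +-congˡ (∑-concatMap g wordsOf (upTo (suc N))) ⟨
    f [] + sumWords N g                                  ∎
    where g = λ w → f (U ∷ w) + (f (H ∷ w) + f (V ∷ w))

  recurrence-identity : ∀ a y k → y * (y + k) + ((a - k) * y + k * (a + y)) ≈ (y + k) * (a + y)
  recurrence-identity a y k = begin
    y * (y + k) + (d * y + k * (a + y))       ≈⟨ +-congˡ (+-congˡ (*-congˡ (+-congʳ a≈d+k))) ⟩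
    y * (y + k) + (d * y + k * ((d + k) + y)) ≈⟨ solve 3 (λ y k d → y :* (y :+ k) :+ (d :* y :+ k :* ((d :+ k) :+ y))
                                                        := (y :+ k) :* ((d :+ k) :+ y)) refl y k d ⟩
    (y + k) * ((d + k) + y)                   ≈⟨ *-congˡ (+-congʳ a≈d+k) ⟨
    (y + k) * (a + y)                         ∎
    where
    d = a - k
    a≈d+k : a ≈ d + k
    a≈d+k = sym (//-rightDividesˡ k a)

  module _ (a : Carrier) where

    pathWeight : ℕ → ℕ → List Step → Carrier
    pathWeight h x w = if validFrom h x w then wtFrom R a h w else 0#

    pathWeight-U : ∀ h x w → pathWeight h (suc x) (U ∷ w) ≈ pathWeight (suc h) x w
    pathWeight-U h x w with validFrom (suc h) x w
    ... | true  = *-identityˡ _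
    ... | false = refl

    pathWeight-H : ∀ h x w → pathWeight h (suc x) (H ∷ w) ≈ (a - ι R h) * pathWeight h x w
    pathWeight-H h x w with validFrom h x w
    ... | true  = refl
    ... | false = sym (zeroʳ _)

    pathWeight-V : ∀ h x w → pathWeight (suc h) x (V ∷ w) ≈ ι R (suc h) * pathWeight h x w
    pathWeight-V h x w rewrite validFrom-V h x w with validFrom h x w
    ... | true  = refl
    ... | false = sym (zeroʳ _)

    pathWeight-V₀ : ∀ x w → pathWeight zero x (V ∷ w) ≈ 0#
    pathWeight-V₀ zero    w = refl
    pathWeight-V₀ (suc x) w = refl

    schSum : ℕ → ℕ → ℕ → Carrier
    schSum N h x = sumWords N (pathWeight h x)

    viaU viaH viaV : (ℕ → ℕ → Carrier) → ℕ → ℕ → Carrier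
    viaU G h zero    = 0#
    viaU G h (suc x) = G (suc h) x
    viaH G h zero    = 0#
    viaH G h (suc x) = (a - ι R h) * G h x
    viaV G zero    x = 0#
    viaV G (suc h) x = ι R (suc h) * G h x

    schStep : (ℕ → ℕ → Carrier) → ℕ → ℕ → Carrier
    schStep G h x = pathWeight h x [] + (viaU G h x + (viaH G h x + viaV G h x))

    schSum-suc : ∀ N h x → schSum (suc N) h x ≈ schStep (schSum N) h x
    schSum-suc N h x = begin
      schSum (suc N) h x
        ≈⟨ sumWords-suc N (pathWeight h x) ⟩
      pathWeight h x [] + ∑ (λ w → ω U w + (ω H w + ω V w)) words
        ≈⟨ +-congˡ (trans (∑-+ (ω U) _ words) (+-congˡ (∑-+ (ω H) (ω V) words))) ⟩
      pathWeight h x [] + (∑ (ω U) words + (∑ (ω H) words + ∑ (ω V) words))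
        ≈⟨ +-congˡ (+-cong (U-part x) (+-cong (H-part x) (V-part h))) ⟩
      schStep (schSum N) h x ∎
      where
      words = concatMap wordsOf (upTo (suc N))
      ω : Step → List Step → Carrier
      ω s w = pathWeight h x (s ∷ w)
      U-part : ∀ x → ∑ (λ w → pathWeight h x (U ∷ w)) words ≈ viaU (schSum N) h x
      U-part zero    = ∑-zero words
      U-part (suc x) = ∑-cong (pathWeight-U h x) words
      H-part : ∀ x → ∑ (λ w → pathWeight h x (H ∷ w)) words ≈ viaH (schSum N) h x
      H-part zero    = ∑-zero words
      H-part (suc x) = trans (∑-cong (pathWeight-H h x) words) (∑-*ˡ _ (pathWeight h x) words)
      V-part : ∀ h → ∑ (λ w → pathWeight h x (V ∷ w)) words ≈ viaV (schSum N) h x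
      V-part zero    = trans (∑-cong (pathWeight-V₀ x) words) (∑-zero words)
      V-part (suc h) = trans (∑-cong (pathWeight-V h x) words) (∑-*ˡ _ (pathWeight h x) words)

    closedForm : ℕ → ℕ → Carrier
    closedForm h x = rising R (ι R (suc x)) h * rising R (a + 1#) x

    closedForm-step : ∀ h x → schStep closedForm h x ≈ closedForm h x
    closedForm-step zero zero = begin
      1# + (0# + (0# + 0#)) ≈⟨ +-congˡ (trans (+-identityˡ _) (+-identityˡ 0#)) ⟩
      1# + 0#               ≈⟨ +-identityʳ 1# ⟩
      1#                    ≈⟨ *-identityˡ 1# ⟨
      1# * 1#               ∎
    closedForm-step zero (suc x) = begin
      0# + (closedForm 1 x + ((a - 0#) * closedForm 0 x + 0#))
        ≈⟨ +-congˡ (+-cong (*-congʳ (rising-one _)) (+-congʳ (*-cong a-0≈a (*-identityˡ p)))) ⟩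
      0# + ((1# + X) * p + (a * p + 0#))
        ≈⟨ solve 4 (λ o X p a → con 0 :+ ((o :+ X) :* p :+ (a :* p :+ con 0)) := p :* ((a :+ o) :+ X)) refl 1# X p a ⟩
      p * ((a + 1#) + X) ≈⟨ rising-sucʳ (a + 1#) x ⟨
      rising R (a + 1#) (suc x) ≈⟨ *-identityˡ _ ⟨
      closedForm 0 (suc x) ∎
      where
      X = ι R x
      p = rising R (a + 1#) x
      a-0≈a : a - 0# ≈ a
      a-0≈a = trans (+-congˡ ε⁻¹≈ε) (+-identityʳ a)
    closedForm-step (suc h) zero = begin
      0# + (0# + (0# + (1# + Hh) * (r * 1#)))
        ≈⟨ solve 3 (λ o Hh r → con 0 :+ (con 0 :+ (con 0 :+ (o :+ Hh) :* (r :* o)))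
                              := (r :* ((o :+ con 0) :+ Hh)) :* o) refl 1# Hh r ⟩
      (r * ((1# + 0#) + Hh)) * 1# ≈⟨ *-congʳ (rising-sucʳ (ι R 1) h) ⟨
      closedForm (suc h) zero ∎
      where
      Hh = ι R h
      r = rising R (ι R 1) h
    closedForm-step (suc h) (suc x) = begin
      0# + (closedForm (suc (suc h)) x + ((a - k) * closedForm (suc h) x + k * closedForm h (suc x)))
        ≈⟨ +-congˡ (+-cong (*-congʳ (trans (rising-sucʳ y (suc h)) (*-congʳ (rising-sucˡ y h))))
                   (+-cong (*-congˡ (*-congʳ (rising-sucˡ y h))) (*-congˡ (*-congˡ (rising-sucʳ (a + 1#) x))))) ⟩
      0# + (((y * r) * (y + k)) * p + ((a - k) * ((y * r) * p) + k * (r * (p * ((a + 1#) + X)))))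
        ≈⟨ solve 7 (λ d a o X Hh r p →
             con 0 :+ ((((o :+ X) :* r) :* ((o :+ X) :+ (o :+ Hh))) :* p
                       :+ (d :* (((o :+ X) :* r) :* p) :+ (o :+ Hh) :* (r :* (p :* ((a :+ o) :+ X)))))
             := (r :* p) :* ((o :+ X) :* ((o :+ X) :+ (o :+ Hh)) :+ (d :* (o :+ X) :+ (o :+ Hh) :* (a :+ (o :+ X)))))
           refl (a - k) a 1# X Hh r p ⟩
      (r * p) * (y * (y + k) + ((a - k) * y + k * (a + y)))
        ≈⟨ *-congˡ (recurrence-identity a y k) ⟩
      (r * p) * ((y + k) * (a + y))
        ≈⟨ solve 6 (λ a o X Hh r p → (r :* p) :* (((o :+ X) :+ (o :+ Hh)) :* (a :+ (o :+ X)))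
                                    := (r :* ((o :+ (o :+ X)) :+ Hh)) :* (p :* ((a :+ o) :+ X))) refl a 1# X Hh r p ⟩
      (r * ((1# + y) + Hh)) * (p * ((a + 1#) + X))
        ≈⟨ *-cong (rising-sucʳ (1# + y) h) (rising-sucʳ (a + 1#) x) ⟨
      closedForm (suc h) (suc x) ∎
      where
      X = ι R x
      Hh = ι R h
      y = ι R (suc x)
      k = ι R (suc h)
      r = rising R (1# + y) h
      p = rising R (a + 1#) x

    schStep-cong : ∀ {G G′ : ℕ → ℕ → Carrier} h x →
                   (∀ h′ x′ → rank h′ x′ < rank h x → G h′ x′ ≈ G′ h′ x′) →
                   schStep G h x ≈ schStep G′ h x
    schStep-cong zero    zero    G≈G′ = refl
    schStep-cong zero    (suc x) G≈G′ =
      +-congˡ (+-cong (G≈G′ 1 x (rank-U 0 x)) (+-congʳ (*-congˡ (G≈G′ 0 x (rank-H 0 x)))))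
    schStep-cong (suc h) zero    G≈G′ =
      +-congˡ (+-congˡ (+-congˡ (*-congˡ (G≈G′ h 0 (rank-V h 0)))))
    schStep-cong (suc h) (suc x) G≈G′ =
      +-congˡ (+-cong (G≈G′ (suc (suc h)) x (rank-U (suc h) x))
                      (+-cong (*-congˡ (G≈G′ (suc h) x (rank-H (suc h) x)))
                              (*-congˡ (G≈G′ h (suc x) (rank-V h (suc x))))))

    schSum≈closedForm : ∀ N h x → rank h x ≤ N → schSum N h x ≈ closedForm h x
    schSum≈closedForm zero    zero    zero    _     = trans (+-identityʳ 1#) (sym (*-identityˡ 1#))
    schSum≈closedForm (suc N) h       x       h,x≤N = begin
      schSum (suc N) h x     ≈⟨ schSum-suc N h x ⟩
      schStep (schSum N) h x ≈⟨ schStep-cong h x (λ h′ x′ lt → schSum≈closedForm N h′ x′ (s≤s⁻¹ (≤-trans lt h,x≤N))) ⟩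
      schStep closedForm h x ≈⟨ closedForm-step h x ⟩
      closedForm h x         ∎

    ∑-Sch : ∀ n → sumR R (map (wt R a) (Sch n)) ≈ schSum (2 *ℕ n) 0 n
    ∑-Sch n = ∑-filterᵇ (validFrom 0 n) (wt R a) (concatMap wordsOf (upTo (suc (2 *ℕ n))))

proposition10p3 : ∀ {c ℓ} (R : CommutativeRing c ℓ) (a : CommutativeRing.Carrier R) (n : ℕ) →
    CommutativeRing._≈_ R (sumR R (map (wt R a) (Sch n))) (rising R (CommutativeRing._+_ R a (CommutativeRing.1# R)) n)
proposition10p3 R a n =
  trans (∑-Sch R a n) (trans (schSum≈closedForm R a (2 *ℕ n) 0 n ≤-refl) (*-identityˡ _))
  where open CommutativeRing R
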